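{- Let $n,m_1,m_3,m_4\in\mathbb{N}$ satisfy $1\leq m_1,m_3,m_4\leq n/10$. Given any tree $T$ with $n$ vertices, there are four edge-disjoint trees $T_1,T_2,T_3,T_4\subset T$ such that $E(T)=\bigcup_{i\in[4]}E(T_i)$, $m_i\leq|T_i|\leq 3m_i$ for each $i\in\{1,3,4\}$, and $T_1\cup T_2$ and $T_1\cup T_2\cup T_3$ are (connected) trees.
   Context: $|T_i|$ denotes the number of vertices of $T_i$. -}

module Defs where

open import Data.Nat using (ℕ; suc; _≤_)
open import Data.Fin using (Fin)
open import Data.Fin.Subset using (Subset; _∈_; _⊆_; _∪_; ⊤)
open import Data.List using (List; []; _∷_; length)
open import Data.List.Relation.Unary.Unique.Propositional using (Unique)
import Data.Empty
open import Data.Product using (Σ; ∃; _×_; _,_)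
open import Data.Sum using (_⊎_)
open import Relation.Nullary using (¬_)

record Graph (n : ℕ) : Set₁ where
  field
    V : Subset n
    E : Fin n → Fin n → Set
open Graph public

record IsGraph {n : ℕ} (G : Graph n) : Set where
  field
    sym     : ∀ {x y} → E G x y → E G y x
    irrefl  : ∀ {x} → ¬ E G x x
    endsInV : ∀ {x y} → E G x y → (x ∈ V G) × (y ∈ V G)

data Walk {n : ℕ} (G : Graph n) : Fin n → Fin n → Set where
  here : ∀ {x} → x ∈ V G → Walk G x x
  step : ∀ {x y z} → E G x y → Walk G y z → Walk G x z

Connected : ∀ {n} → Graph n → Set
Connected G = ∀ {x y} → x ∈ V G → y ∈ V G → Walk G x y

data Chain {n : ℕ} (G : Graph n) : List (Fin n) → Set where
  []  : Chain G []
  [_] : ∀ x → Chain G (x ∷ [])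
  _∷_ : ∀ {x y xs} → E G x y → Chain G (y ∷ xs) → Chain G (x ∷ y ∷ xs)

lastOf : ∀ {n} → Fin n → List (Fin n) → Fin n
lastOf x []       = x
lastOf x (y ∷ ys) = lastOf y ys

-- A cycle: distinct vertices v₀ v₁ … v_k (given as v₀ ∷ vs) with k ≥ 2,
-- consecutive ones adjacent, and v_k adjacent to v₀.
IsCycle : ∀ {n} → Graph n → Fin n → List (Fin n) → Set
IsCycle G v vs =
  (2 ≤ length vs) × Unique (v ∷ vs) × Chain G (v ∷ vs) × E G (lastOf v vs) v

Acyclic : ∀ {n} → Graph n → Set
Acyclic G = ∀ v vs → ¬ IsCycle G v vs

record IsTree {n : ℕ} (G : Graph n) : Set where
  field
    isGraph   : IsGraph G
    nonempty  : ∃ λ x → x ∈ V G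
    connected : Connected G
    acyclic   : Acyclic G

_⊑_ : ∀ {n} → Graph n → Graph n → Set
H ⊑ G = (V H ⊆ V G) × (∀ {x y} → E H x y → E G x y)

EdgeDisjoint : ∀ {n} → Graph n → Graph n → Set
EdgeDisjoint G H = ∀ {x y} → E G x y → E H x y → Data.Empty.⊥

_∪G_ : ∀ {n} → Graph n → Graph n → Graph n
G ∪G H = record { V = V G ∪ V H ; E = λ x y → E G x y ⊎ E H x y }

onAll : ∀ {n} → (Fin n → Fin n → Set) → Graph n
onAll E = record { V = ⊤ ; E = E }

{-# OPTIONS --safe #-}
-- Root T at a vertex r, so that every edge joins some x ≠ r to its parent, and call a
-- parent-closed vertex set containing r a region. In a region R with at least m vertices,
-- descend from r to a vertex u whose R-subtree has at least m vertices while each child's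
-- has fewer; adding the subtrees of the children to u one at a time, the size first
-- reaches m below 2m. Removing this piece, except for u, leaves a region, and every parent
-- edge of R lies in the piece or in the remaining region. As every mᵢ ≤ n/10, pieces for
-- m₄, m₃ and m₁ can be peeled off T in turn; they are T₄, T₃, T₁, and the final region is
-- T₂. A piece hangs from its top vertex and T₁ ∪ T₂, T₁ ∪ T₂ ∪ T₃ are regions, so all are
-- trees; distinct parts share at most one vertex, hence no edge.
module Submission where

open import Defs
open import Data.Bool using (true)
open import Data.Fin using (Fin) renaming (_≟_ to _≟ᶠ_)
import Data.Fin.Properties as Fin
open import Data.Fin.Subset using (Subset; _⊆_; _∪_; ∣_∣; ⁅_⁆; ⊤; inside; outside)
open import Data.Fin.Subset.Properties
  using ( ∈⊤; x∈p∪q⁺; x∈p∪q⁻; p⊆p∪q; q⊆p∪q; p⊆q⇒∣p∣≤∣q∣; p⊂q⇒∣p∣<∣q∣; ∣p∣≤∣x∷p∣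
        ; ∣⁅x⁆∣≡1; x∈⁅x⁆; ∣⊤∣≡n)
open import Data.List using (List; []; _∷_; allFin)
open import Data.List.Membership.Propositional.Properties using (∈-allFin)
open import Data.List.Relation.Unary.Any as Any using (Any; here; there)
open import Data.Nat using (ℕ; suc; _+_; _*_; _≤_; _<_; z≤n; s≤s; _≤?_)
open import Data.Nat.DivMod using (_/_; m/n*n≤m)
open import Data.Nat.Induction using (<-wellFounded)
open import Data.Nat.Properties
  using ( ≤-refl; ≤-reflexive; ≤-trans; ≤-<-trans; <-≤-trans; <⇒≤; n≤1+n; n<1+n; 1+n≰n; ≰⇒>; m≤m+n
        ; +-suc; +-assoc; *-comm; +-mono-≤; +-mono-<; +-monoˡ-≤; +-monoʳ-≤; +-cancelˡ-≤; module ≤-Reasoning)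
open import Data.Product using (Σ-syntax; _×_; _,_; proj₁; proj₂)
import Data.Product as Product
open import Data.Sum using (_⊎_; inj₁; inj₂; [_,_]′)
import Data.Sum as Sum
open import Data.Vec using ([]; _∷_; tabulate)
open import Data.Vec.Properties using (lookup∘tabulate; []=⇒lookup; lookup⇒[]=)
open import Function using (_∘_; id)
import Induction.WellFounded as WF
import Relation.Binary.Construct.On as On
open import Relation.Binary.PropositionalEquality using (_≡_; _≢_; refl; sym; trans; cong; subst)
open import Relation.Nullary using (¬_; Dec; yes; no; ¬?; does; contradiction)
open import Relation.Nullary.Decidable using (_×-dec_; _⊎-dec_)
open import Relation.Unary using (Pred; Decidable)

module _ {n ℓ} {P : Pred (Fin n) ℓ} (P? : Decidable P) where

  open import Data.Fin.Subset using (_∈_)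

  subset : Subset n
  subset = tabulate (λ x → does (P? x))

  ∈-subset⁺ : ∀ {x} → P x → x ∈ subset
  ∈-subset⁺ {x} px = lookup⇒[]= x subset (trans (lookup∘tabulate _ x) (does-true (P? x)))
    where
      does-true : ∀ d → does d ≡ true
      does-true (yes _)  = refl
      does-true (no ¬px) = contradiction px ¬px

  ∈-subset⁻ : ∀ {x} → x ∈ subset → P x
  ∈-subset⁻ {x} x∈ = witness (P? x) (trans (sym (lookup∘tabulate _ x)) ([]=⇒lookup x∈))
    where
      witness : ∀ d → does d ≡ true → P x
      witness (yes px) _ = px

∣p∪q∣≤∣p∣+∣q∣ : ∀ {n} (p q : Subset n) → ∣ p ∪ q ∣ ≤ ∣ p ∣ + ∣ q ∣
∣p∪q∣≤∣p∣+∣q∣ []            []            = z≤n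
∣p∪q∣≤∣p∣+∣q∣ (inside ∷ p)  (s ∷ q)       =
  s≤s (≤-trans (∣p∪q∣≤∣p∣+∣q∣ p q) (+-monoʳ-≤ ∣ p ∣ (∣p∣≤∣x∷p∣ s q)))
∣p∪q∣≤∣p∣+∣q∣ (outside ∷ p) (inside ∷ q)  =
  subst (suc ∣ p ∪ q ∣ ≤_) (sym (+-suc ∣ p ∣ ∣ q ∣)) (s≤s (∣p∪q∣≤∣p∣+∣q∣ p q))
∣p∪q∣≤∣p∣+∣q∣ (outside ∷ p) (outside ∷ q) = ∣p∪q∣≤∣p∣+∣q∣ p q

measure-rec : ∀ {a ℓ} {A : Set a} (f : A → ℕ) (P : Pred A ℓ) →
              (∀ x → (∀ {y} → f y < f x → P y) → P x) → ∀ x → P x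
measure-rec f P hyp = WF.All.wfRec (On.wellFounded f <-wellFounded) _ P hyp

window : ∀ {a} {A : Set a} {m b} (f : List A → ℕ) → f [] < b →
         (∀ x xs → f xs < m → f (x ∷ xs) < b) →
         ∀ xs → m ≤ f xs → Σ[ ys ∈ List A ] m ≤ f ys × f ys < b
window f f[]<b grow [] m≤f = [] , m≤f , f[]<b
window {m = m} f f[]<b grow (x ∷ xs) m≤f with m ≤? f xs
... | yes m≤f′ = window f f[]<b grow xs m≤f′
... | no  m≰f′ = x ∷ xs , m≤f , grow x xs (≰⇒> m≰f′)

∪G-isGraph : ∀ {n} {G H : Graph n} → IsGraph G → IsGraph H → IsGraph (G ∪G H)
∪G-isGraph {G = G} {H} g h = record
  { sym     = Sum.map (IsGraph.sym g) (IsGraph.sym h)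
  ; irrefl  = [ IsGraph.irrefl g , IsGraph.irrefl h ]′
  ; endsInV = [ Product.map (p⊆p∪q (V H)) (p⊆p∪q (V H)) ∘ IsGraph.endsInV g
              , Product.map (q⊆p∪q (V G) (V H)) (q⊆p∪q (V G) (V H)) ∘ IsGraph.endsInV h ]′
  }

_++ʷ_ : ∀ {n} {G : Graph n} {x y z} → Walk G x y → Walk G y z → Walk G x z
here _   ++ʷ w′ = w′
step e w ++ʷ w′ = step e (w ++ʷ w′)

reverseʷ : ∀ {n} {G : Graph n} → IsGraph G → ∀ {x y} → Walk G x y → Walk G y x
reverseʷ g (here x∈)  = here x∈
reverseʷ g (step e w) = reverseʷ g w ++ʷ step (IsGraph.sym g e) (here (proj₁ (IsGraph.endsInV g e)))

Chain-map : ∀ {n} {G H : Graph n} → (∀ {x y} → E H x y → E G x y) → ∀ {xs} → Chain H xs → Chain G xs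
Chain-map f []      = []
Chain-map f [ x ]   = [ x ]
Chain-map f (e ∷ c) = f e ∷ Chain-map f c

Acyclic-mono : ∀ {n} {G H : Graph n} → (∀ {x y} → E H x y → E G x y) → Acyclic G → Acyclic H
Acyclic-mono f acyclic v vs (long , unique , chain , closing) =
  acyclic v vs (long , unique , Chain-map f chain , f closing)

∪G-⊑ : ∀ {n} {G H K : Graph n} → G ⊑ K → H ⊑ K → (G ∪G H) ⊑ K
∪G-⊑ {G = G} {H} (VG⊆ , EG⊆) (VH⊆ , EH⊆) = [ VG⊆ , VH⊆ ]′ ∘ x∈p∪q⁻ (V G) (V H) , [ EG⊆ , EH⊆ ]′

record Arborescence (n : ℕ) : Set where
  field
    root         : Fin n
    parent       : Fin n → Fin n
    depth        : Fin n → ℕ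
    depth-parent : ∀ {x} → x ≢ root → depth x ≡ suc (depth (parent x))

record Rooting {n : ℕ} (ET : Fin n → Fin n → Set) : Set where
  field
    arborescence : Arborescence n
  open Arborescence arborescence public
  field
    parent-adjacent : ∀ {x} → x ≢ root → ET x (parent x)
    adjacent⇒parent : ∀ {x y} → ET x y → (x ≢ root × parent x ≡ y) ⊎ (y ≢ root × parent y ≡ x)

module Paths where

  open import Data.List using (_++_; reverse; length)
  open import Data.List.Properties using (unfold-reverse; ++-assoc; length-reverse; length-++)
  open import Data.List.Membership.Propositional using (_∈_; _∉_)
  open import Data.List.Membership.Propositional.Properties using (∈-++⁺ˡ; ∈-++⁺ʳ; ∈-++⁻; ∈-∃++)
  open import Data.List.Relation.Unary.All as All using (All; []; _∷_)
  open import Data.List.Relation.Unary.All.Properties using (¬Any⇒All¬; All¬⇒¬Any; ++⁻ˡ)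
  open import Data.List.Relation.Unary.Any.Properties using (reverse⁻)
  open import Data.List.Relation.Unary.Unique.Propositional using (Unique)
  open import Data.List.Relation.Unary.Unique.Propositional.Properties using (++⁺; Unique[x∷xs]⇒x∉xs)
  open import Data.List.Relation.Unary.AllPairs using ([]; _∷_)
  open import Data.List.Relation.Binary.Permutation.Propositional using (↭-sym; ↭⇒↭ₛ)
  open import Data.List.Relation.Binary.Permutation.Propositional.Properties using (↭-reverse)
  import Data.List.Relation.Binary.Permutation.Setoid.Properties as Permutationₛ
  open import Data.Empty using (⊥)
  open import Data.Nat.Properties using (<-asym; m≤n+m)
  open import Relation.Binary.Definitions using (Symmetric)
  open import Relation.Binary.PropositionalEquality using (setoid)

  module _ {n : ℕ} where

    open import Data.List.Membership.DecPropositional (_≟ᶠ_ {n}) using (_∈?_)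

    module _ {G : Graph n} where

      Chain-prefix : ∀ xs {y ys} → Chain G (xs ++ y ∷ ys) → Chain G (xs ++ y ∷ [])
      Chain-prefix []            {y} _ = [ y ]
      Chain-prefix (x ∷ [])      (e ∷ _) = e ∷ [ _ ]
      Chain-prefix (x ∷ x′ ∷ xs) (e ∷ c) = e ∷ Chain-prefix (x′ ∷ xs) c

      Chain-join : ∀ xs {c ys} → Chain G (xs ++ c ∷ []) → Chain G (c ∷ ys) → Chain G (xs ++ c ∷ ys)
      Chain-join []            _       c′ = c′
      Chain-join (x ∷ [])      (e ∷ _) c′ = e ∷ c′
      Chain-join (x ∷ x′ ∷ xs) (e ∷ c) c′ = e ∷ Chain-join (x′ ∷ xs) c c′

      Chain-∷ʳ⁺ : ∀ a xs {w} → Chain G (a ∷ xs) → E G (lastOf a xs) w → Chain G (a ∷ xs ++ w ∷ [])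
      Chain-∷ʳ⁺ a []       [ a ]   e′ = e′ ∷ [ _ ]
      Chain-∷ʳ⁺ a (x ∷ xs) (e ∷ c) e′ = e ∷ Chain-∷ʳ⁺ x xs c e′

      Chain-∷ʳ⁻ : ∀ a xs {w} → Chain G (a ∷ xs ++ w ∷ []) → Chain G (a ∷ xs) × E G (lastOf a xs) w
      Chain-∷ʳ⁻ a []       (e ∷ _) = [ a ] , e
      Chain-∷ʳ⁻ a (x ∷ xs) (e ∷ c) = Product.map₁ (e ∷_) (Chain-∷ʳ⁻ x xs c)

    lastOf-∷ʳ : ∀ (a : Fin n) xs w → lastOf a (xs ++ w ∷ []) ≡ w
    lastOf-∷ʳ a []       w = refl
    lastOf-∷ʳ a (x ∷ xs) w = lastOf-∷ʳ x xs w

    lastOf-∈ : ∀ (a : Fin n) xs → lastOf a xs ∈ a ∷ xs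
    lastOf-∈ a []       = here refl
    lastOf-∈ a (x ∷ xs) = there (lastOf-∈ x xs)

    Chain-reverse : ∀ {G : Graph n} → Symmetric (E G) → ∀ {a c} xs →
                    Chain G (a ∷ xs ++ c ∷ []) → Chain G (c ∷ reverse xs ++ a ∷ [])
    Chain-reverse symm []       (e ∷ _) = symm e ∷ [ _ ]
    Chain-reverse {G} symm {a} {c} (x ∷ xs) (e ∷ ch) rewrite unfold-reverse x xs =
      Chain-∷ʳ⁺ c (reverse xs ++ x ∷ []) (Chain-reverse symm xs ch)
                (subst (λ v → E G v a) (sym (lastOf-∷ʳ c (reverse xs) x)) (symm e))

    Unique-++⁻ˡ : ∀ (xs : List (Fin n)) {ys} → Unique (xs ++ ys) → Unique xs
    Unique-++⁻ˡ []       _          = []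
    Unique-++⁻ˡ (x ∷ xs) (x∉ ∷ u)   = ++⁻ˡ xs x∉ ∷ Unique-++⁻ˡ xs u

    Unique-++-∷⇒∉ : ∀ (xs : List (Fin n)) {y ys} → Unique (xs ++ y ∷ ys) → y ∉ xs
    Unique-++-∷⇒∉ (x ∷ xs) u         (here refl) = Unique[x∷xs]⇒x∉xs u (∈-++⁺ʳ xs (here refl))
    Unique-++-∷⇒∉ (x ∷ xs) (_ ∷ u)   (there y∈)  = Unique-++-∷⇒∉ xs u y∈

    Unique-reverse : ∀ {xs : List (Fin n)} → Unique xs → Unique (reverse xs)
    Unique-reverse {xs} = Permutationₛ.Unique-resp-↭ (setoid (Fin n)) (↭⇒↭ₛ (↭-sym (↭-reverse xs)))

    record SimplePath (G : Graph n) (a : Fin n) (xs : List (Fin n)) (b : Fin n) : Set where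
      constructor simplePath
      field
        unique : Unique (a ∷ xs)
        chain  : Chain G (a ∷ xs)
        ends   : lastOf a xs ≡ b
    open SimplePath

    module _ {G : Graph n} where

      SimplePath-tail : ∀ {a x xs b} → SimplePath G a (x ∷ xs) b → SimplePath G x xs b
      SimplePath-tail (simplePath (_ ∷ u) (_ ∷ c) l) = simplePath u c l

      SimplePath-∷ : ∀ {a x xs b} → a ∉ x ∷ xs → E G a x → SimplePath G x xs b → SimplePath G a (x ∷ xs) b
      SimplePath-∷ a∉ e (simplePath u c l) = simplePath (¬Any⇒All¬ _ a∉ ∷ u) (e ∷ c) l

      SimplePath-drop : ∀ ys {a x zs b} → SimplePath G a (ys ++ x ∷ zs) b → SimplePath G x zs b
      SimplePath-drop []       s = SimplePath-tail s
      SimplePath-drop (y ∷ ys) s = SimplePath-drop ys (SimplePath-tail s)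

      SimplePath-suffix : ∀ {a xs b x} → x ∈ xs → SimplePath G a xs b →
                          Σ[ zs ∈ List (Fin n) ] SimplePath G x zs b × length zs < length xs
      SimplePath-suffix x∈ s with ∈-∃++ x∈
      ... | ys , zs , refl =
        zs , SimplePath-drop ys s , subst (length zs <_) (sym (length-++ ys)) (m≤n+m _ (length ys))

      walk⇒SimplePath : ∀ {x y} → Walk G x y → Σ[ xs ∈ List (Fin n) ] SimplePath G x xs y
      walk⇒SimplePath (here _) = [] , simplePath ([] ∷ []) [ _ ] refl
      walk⇒SimplePath (step {x} {y} e w) with walk⇒SimplePath w
      ... | ys , s with x ∈? y ∷ ys
      ...   | no  x∉         = y ∷ ys , SimplePath-∷ x∉ e s
      ...   | yes (here refl) = ys , s
      ...   | yes (there x∈)  = Product.map₂ proj₁ (SimplePath-suffix x∈ s)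

    first-common : ∀ (L₁ L₂ : List (Fin n)) {v} → v ∈ L₁ → v ∈ L₂ →
                   Σ[ α ∈ List (Fin n) ] Σ[ c ∈ Fin n ] Σ[ ρ ∈ List (Fin n) ]
                     L₁ ≡ α ++ c ∷ ρ × All (_∉ L₂) α × c ∈ L₂
    first-common (x ∷ xs) L₂ v∈₁ v∈₂ with x ∈? L₂ | v∈₁
    ... | yes x∈ | _           = [] , x , xs , refl , [] , x∈
    ... | no  x∉ | here refl   = contradiction v∈₂ x∉
    ... | no  x∉ | there v∈xs with first-common xs L₂ v∈xs v∈₂
    ...   | α , c , ρ , refl , α∉ , c∈ = x ∷ α , c , ρ , refl , x∉ ∷ α∉ , c∈

    module _ {G : Graph n} (symm : Symmetric (E G)) where

      -- Out from a along α to the first common vertex c, and back to a along β.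
      cycle-of-routes : ∀ {a c b b′} α β {ρ σ} →
        SimplePath G a (α ++ c ∷ ρ) b → SimplePath G a (β ++ c ∷ σ) b′ →
        All (_∉ β) α → (α ≡ [] → β ≡ [] → ⊥) → IsCycle G a (α ++ c ∷ reverse β)
      cycle-of-routes {a} {c} α β (simplePath (a∉₁ ∷ u₁) ch₁ _) (simplePath (a∉₂ ∷ u₂) ch₂ _)
                      α∉β not-both-[] =
        long-enough α β not-both-[] , ¬Any⇒All¬ _ a∉cycle ∷ unique-cycle , Chain-∷ʳ⁻ a cycle closed
        where
          cycle : List (Fin n)
          cycle = α ++ c ∷ reverse β

          long-enough : ∀ α β → (α ≡ [] → β ≡ [] → ⊥) → 2 ≤ length (α ++ c ∷ reverse β)
          long-enough []      []      not-both-[] = contradiction refl (not-both-[] refl)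
          long-enough []      (x ∷ β) _           =
            subst (λ k → 2 ≤ suc k) (sym (length-reverse (x ∷ β))) (s≤s (s≤s z≤n))
          long-enough (x ∷ α) β       _           =
            s≤s (subst (1 ≤_) (sym (length-++ α)) (≤-trans (s≤s z≤n) (m≤n+m _ (length α))))

          closed : Chain G (a ∷ cycle ++ a ∷ [])
          closed = subst (λ L → Chain G (a ∷ L)) (sym (++-assoc α (c ∷ reverse β) (a ∷ [])))
                     (Chain-join (a ∷ α) (Chain-prefix (a ∷ α) ch₁) (Chain-reverse symm β (Chain-prefix (a ∷ β) ch₂)))

          a∉cycle : a ∉ cycle
          a∉cycle a∈ with ∈-++⁻ α a∈
          ... | inj₁ a∈α         = All¬⇒¬Any a∉₁ (∈-++⁺ˡ a∈α)
          ... | inj₂ (here refl) = All¬⇒¬Any a∉₁ (∈-++⁺ʳ α (here refl))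
          ... | inj₂ (there a∈)  = All¬⇒¬Any a∉₂ (∈-++⁺ˡ (reverse⁻ {xs = β} a∈))

          unique-cycle : Unique cycle
          unique-cycle = ++⁺ (Unique-++⁻ˡ α u₁)
            (¬Any⇒All¬ _ (Unique-++-∷⇒∉ β u₂ ∘ reverse⁻ {xs = β}) ∷ Unique-reverse (Unique-++⁻ˡ β u₂))
            λ { (v∈α , here refl) → Unique-++-∷⇒∉ α u₁ v∈α
              ; (v∈α , there v∈)  → All.lookup α∉β v∈α (reverse⁻ {xs = β} v∈) }

      module _ (acyclic : Acyclic G) where

        private
          head-of : ∀ {x : Fin n} {xs c ρ} α → x ∷ xs ≡ α ++ c ∷ ρ → α ≡ [] → x ≡ c
          head-of .[] refl refl = refl

        routes-agree-on-first-step : ∀ {a u w P Q b} → SimplePath G a (u ∷ P) b → SimplePath G a (w ∷ Q) b → u ≡ w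
        routes-agree-on-first-step {a} {u} {w} {P} {Q} {b} s₁ s₂ with u ≟ᶠ w
        ... | yes u≡w = u≡w
        ... | no  u≢w
          with first-common (u ∷ P) (w ∷ Q) (subst (_∈ u ∷ P) (ends s₁) (lastOf-∈ u P))
                                            (subst (_∈ w ∷ Q) (ends s₂) (lastOf-∈ w Q))
        ... | α , c , ρ , eq₁ , α∉ , c∈ with ∈-∃++ c∈
        ... | β , σ , eq₂ = contradiction
              (cycle-of-routes α β (subst (λ L → SimplePath G a L b) eq₁ s₁)
                                   (subst (λ L → SimplePath G a L b) eq₂ s₂)
                 (All.map (λ v∉ v∈β → v∉ (subst (_ ∈_) (sym eq₂) (∈-++⁺ˡ v∈β))) α∉)
                 (λ α≡[] β≡[] → u≢w (trans (head-of α eq₁ α≡[]) (sym (head-of β eq₂ β≡[])))))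
              (acyclic a _)

        SimplePath-unique : ∀ {a xs ys b} → SimplePath G a xs b → SimplePath G a ys b → xs ≡ ys
        SimplePath-unique {xs = []}     {[]}     _  _  = refl
        SimplePath-unique {xs = []}     {w ∷ Q}  s₁ s₂ =
          contradiction (subst (_∈ w ∷ Q) (trans (ends s₂) (sym (ends s₁))) (lastOf-∈ w Q)) (Unique[x∷xs]⇒x∉xs (unique s₂))
        SimplePath-unique {xs = u ∷ P}  {[]}     s₁ s₂ =
          contradiction (subst (_∈ u ∷ P) (trans (ends s₁) (sym (ends s₂))) (lastOf-∈ u P)) (Unique[x∷xs]⇒x∉xs (unique s₁))
        SimplePath-unique {xs = u ∷ P}  {w ∷ Q}  s₁ s₂ with routes-agree-on-first-step s₁ s₂
        ... | refl = cong (u ∷_) (SimplePath-unique (SimplePath-tail s₁) (SimplePath-tail s₂))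

  module _ {n : ℕ} {ET : Fin n → Fin n → Set} (tree : IsTree (onAll ET)) where

    open IsTree tree
    open SimplePath
    open import Data.List.Membership.DecPropositional (_≟ᶠ_ {n}) using (_∈?_)

    private
      root : Fin n
      root = proj₁ nonempty

      toRoot : Fin n → List (Fin n)
      toRoot x = proj₁ (walk⇒SimplePath (connected {x} {root} ∈⊤ ∈⊤))

      toRoot-simple : ∀ x → SimplePath (onAll ET) x (toRoot x) root
      toRoot-simple x = proj₂ (walk⇒SimplePath (connected {x} {root} ∈⊤ ∈⊤))

      toRoot-unique : ∀ {x xs} → SimplePath (onAll ET) x xs root → toRoot x ≡ xs
      toRoot-unique = SimplePath-unique (IsGraph.sym isGraph) acyclic (toRoot-simple _)

      headOrRoot : List (Fin n) → Fin n
      headOrRoot []      = root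
      headOrRoot (y ∷ _) = y

      parent : Fin n → Fin n
      parent x = headOrRoot (toRoot x)

      depth : Fin n → ℕ
      depth x = length (toRoot x)

      toRoot-root : toRoot root ≡ []
      toRoot-root = toRoot-unique (simplePath ([] ∷ []) [ root ] refl)

      toRoot-∷ : ∀ {x} → x ≢ root → toRoot x ≡ parent x ∷ toRoot (parent x)
      toRoot-∷ {x} = unfold (toRoot x) (toRoot-simple x)
        where
          unfold : ∀ L → SimplePath (onAll ET) x L root → x ≢ root → L ≡ headOrRoot L ∷ toRoot (headOrRoot L)
          unfold []       s x≢r = contradiction (ends s) x≢r
          unfold (y ∷ ys) s _   = cong (y ∷_) (sym (toRoot-unique (SimplePath-tail s)))

      parent-adjacent : ∀ {x} → x ≢ root → ET x (parent x)
      parent-adjacent {x} x≢r with subst (λ L → Chain (onAll ET) (x ∷ L)) (toRoot-∷ x≢r) (chain (toRoot-simple x))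
      ... | e ∷ _ = e

      adjacent-parent : ∀ {x y} → ET x y → x ∉ y ∷ toRoot y → x ≢ root × parent x ≡ y
      adjacent-parent {x} {y} e x∉ = x≢r , cong headOrRoot toRoot-x
        where
          toRoot-x : toRoot x ≡ y ∷ toRoot y
          toRoot-x = toRoot-unique (SimplePath-∷ x∉ e (toRoot-simple y))
          x≢r : x ≢ root
          x≢r refl with trans (sym toRoot-root) toRoot-x
          ... | ()

      adjacent-below : ∀ {x y} → ET x y → x ∈ y ∷ toRoot y → depth x < depth y
      adjacent-below e (here refl) = contradiction e (IsGraph.irrefl isGraph)
      adjacent-below {x} {y} e (there x∈) with SimplePath-suffix x∈ (toRoot-simple y)
      ... | zs , s , shorter = subst (_< depth y) (sym (cong length (toRoot-unique s))) shorter

      adjacent⇒parent : ∀ {x y} → ET x y → (x ≢ root × parent x ≡ y) ⊎ (y ≢ root × parent y ≡ x)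
      adjacent⇒parent {x} {y} e with x ∈? y ∷ toRoot y | y ∈? x ∷ toRoot x
      ... | no  x∉ | _      = inj₁ (adjacent-parent e x∉)
      ... | yes _  | no  y∉ = inj₂ (adjacent-parent (IsGraph.sym isGraph e) y∉)
      ... | yes x∈ | yes y∈ = contradiction (adjacent-below e x∈) (<-asym (adjacent-below (IsGraph.sym isGraph e) y∈))

    tree⇒Rooting : Rooting ET
    tree⇒Rooting = record
      { arborescence    = record { root = root ; parent = parent ; depth = depth
                                 ; depth-parent = cong length ∘ toRoot-∷ }
      ; parent-adjacent = parent-adjacent
      ; adjacent⇒parent = adjacent⇒parent
      }

open Paths using (tree⇒Rooting)

module Ancestry {n : ℕ} (A : Arborescence n) where

  open import Data.Fin.Subset using (_∈_)

  open Arborescence A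

  infix 4 _≼_ _≼?_

  data _≼_ (u : Fin n) : Fin n → Set where
    here  : u ≼ u
    there : ∀ {x} → x ≢ root → u ≼ parent x → u ≼ x

  depth-rec : ∀ {ℓ} (P : Fin n → Set ℓ) → (∀ x → (x ≢ root → P (parent x)) → P x) → ∀ x → P x
  depth-rec P hyp = measure-rec depth P λ x rec →
    hyp x λ x≢r → rec (subst (depth (parent x) <_) (sym (depth-parent x≢r)) (n<1+n _))

  ≼-trans : ∀ {u v x} → u ≼ v → v ≼ x → u ≼ x
  ≼-trans u≼v here            = u≼v
  ≼-trans u≼v (there x≢r v≼p) = there x≢r (≼-trans u≼v v≼p)

  parent≼ : ∀ {x} → x ≢ root → parent x ≼ x
  parent≼ x≢r = there x≢r here

  root≼ : ∀ x → root ≼ x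
  root≼ = depth-rec (root ≼_) climb
    where
      climb : ∀ x → (x ≢ root → root ≼ parent x) → root ≼ x
      climb x rec with x ≟ᶠ root
      ... | yes refl = here
      ... | no  x≢r  = there x≢r (rec x≢r)

  ≼-root : ∀ {u} → u ≼ root → u ≡ root
  ≼-root here          = refl
  ≼-root (there r≢r _) = contradiction refl r≢r

  ≼⇒depth≤ : ∀ {u x} → u ≼ x → depth u ≤ depth x
  ≼⇒depth≤ here                  = ≤-refl
  ≼⇒depth≤ (there {x} x≢r u≼p) =
    ≤-trans (≼⇒depth≤ u≼p) (subst (depth (parent x) ≤_) (sym (depth-parent x≢r)) (n≤1+n _))

  ⋠-parent : ∀ {x} → x ≢ root → ¬ (x ≼ parent x)
  ⋠-parent {x} x≢r x≼p = 1+n≰n (subst (_≤ depth (parent x)) (depth-parent x≢r) (≼⇒depth≤ x≼p))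

  _≼?_ : ∀ u x → Dec (u ≼ x)
  u ≼? x = depth-rec (λ x → Dec (u ≼ x)) decide x
    where
      decide : ∀ x → (x ≢ root → Dec (u ≼ parent x)) → Dec (u ≼ x)
      decide x rec with u ≟ᶠ x | x ≟ᶠ root
      ... | yes refl | _        = yes here
      ... | no  u≢x  | yes refl = no λ { here → u≢x refl ; (there r≢r _) → r≢r refl }
      ... | no  u≢x  | no  x≢r  with rec x≢r
      ...   | yes u≼p = yes (there x≢r u≼p)
      ...   | no  u⋠p = no λ { here → u≢x refl ; (there _ u≼p) → u⋠p u≼p }

  ≼-child : ∀ {u x} → u ≼ x → u ≢ x → Σ[ c ∈ Fin n ] (c ≢ root × parent c ≡ u) × c ≼ x
  ≼-child here u≢u = contradiction refl u≢u
  ≼-child {u} (there {x} x≢r u≼p) _ with u ≟ᶠ parent x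
  ... | yes refl = x , (x≢r , refl) , here
  ... | no  u≢p  with ≼-child u≼p u≢p
  ...   | c , c-child , c≼p = c , c-child , there x≢r c≼p

  RootedAt : Fin n → Subset n → Set
  RootedAt t S = t ∈ S × (∀ {x} → x ∈ S → x ≢ t → x ≢ root × parent x ∈ S)

  Region : Subset n → Set
  Region = RootedAt root

  ⊤-region : Region ⊤
  ⊤-region = ∈⊤ , λ _ x≢r → x≢r , ∈⊤

  Region-≼ : ∀ {R u x} → Region R → x ∈ R → u ≼ x → u ∈ R
  Region-≼ R-region x∈ here            = x∈
  Region-≼ R-region x∈ (there x≢r u≼p) = Region-≼ R-region (proj₂ (proj₂ R-region x∈ x≢r)) u≼p

module Splitting {n : ℕ} (A : Arborescence n) where

  open import Data.Fin.Subset using (_∈_; _∉_)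
  open import Data.Fin.Subset.Properties using (_∈?_)

  open Arborescence A
  open Ancestry A

  record Split (R : Subset n) (m : ℕ) : Set where
    field
      top          : Fin n
      piece        : Subset n
      piece-rooted : RootedAt top piece
      piece⊆R      : piece ⊆ R
      top≼         : ∀ {x} → x ∈ piece → top ≼ x
      piece-down   : ∀ {x} → x ∈ R → x ≢ root → parent x ∈ piece → parent x ≢ top → x ∈ piece
      m≤∣piece∣    : m ≤ ∣ piece ∣
      ∣piece∣<2m   : ∣ piece ∣ < m + m

  module _ {R : Subset n} (R-region : Region R) {m : ℕ} (1≤m : 1 ≤ m) where

    InSubtree? : ∀ c x → Dec (x ∈ R × c ≼ x)
    InSubtree? c x = (x ∈? R) ×-dec (c ≼? x)

    subtree : Fin n → Subset n
    subtree c = subset (InSubtree? c)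

    ∈-subtree⁺ : ∀ {c x} → x ∈ R → c ≼ x → x ∈ subtree c
    ∈-subtree⁺ x∈R c≼x = ∈-subset⁺ (InSubtree? _) (x∈R , c≼x)

    ∈-subtree⁻ : ∀ {c x} → x ∈ subtree c → x ∈ R × c ≼ x
    ∈-subtree⁻ = ∈-subset⁻ (InSubtree? _)

    Child : Fin n → Fin n → Set
    Child u c = c ∈ R × c ≢ root × parent c ≡ u

    child? : ∀ u c → Dec (Child u c)
    child? u c = (c ∈? R) ×-dec ¬? (c ≟ᶠ root) ×-dec (parent c ≟ᶠ u)

    ∣subtree∣-child< : ∀ {u c} → Child u c → ∣ subtree c ∣ < ∣ subtree u ∣
    ∣subtree∣-child< {u} {c} (c∈R , c≢r , refl) = p⊂q⇒∣p∣<∣q∣ (subtree-c⊆ , u , u∈ , u∉)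
      where
        subtree-c⊆ : subtree c ⊆ subtree u
        subtree-c⊆ x∈ = let x∈R , c≼x = ∈-subtree⁻ x∈ in ∈-subtree⁺ x∈R (≼-trans (parent≼ c≢r) c≼x)
        u∈ : u ∈ subtree u
        u∈ = ∈-subtree⁺ (proj₂ (proj₂ R-region c∈R c≢r)) here
        u∉ : u ∉ subtree c
        u∉ u∈c = ⋠-parent c≢r (proj₂ (∈-subtree⁻ u∈c))

    R⊆subtree-root : R ⊆ subtree root
    R⊆subtree-root {x} x∈R = ∈-subtree⁺ x∈R (root≼ x)

    HeavyVertex : Set
    HeavyVertex = Σ[ u ∈ Fin n ] u ∈ R × m ≤ ∣ subtree u ∣ × (∀ {c} → Child u c → ∣ subtree c ∣ < m)

    heavy-below : ∀ u → u ∈ R → m ≤ ∣ subtree u ∣ → HeavyVertex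
    heavy-below = measure-rec (λ u → ∣ subtree u ∣) _ descend
      where
        descend : ∀ u → (∀ {c} → ∣ subtree c ∣ < ∣ subtree u ∣ → c ∈ R → m ≤ ∣ subtree c ∣ → HeavyVertex) →
               u ∈ R → m ≤ ∣ subtree u ∣ → HeavyVertex
        descend u rec u∈R m≤ with Fin.any? (λ c → child? u c ×-dec (m ≤? ∣ subtree c ∣))
        ... | yes (c , c-child , m≤c) = rec (∣subtree∣-child< c-child) (proj₁ c-child) m≤c
        ... | no  none                = u , u∈R , m≤ , λ {c} c-child → ≰⇒> λ m≤c → none (c , c-child , m≤c)

    module Piece (u : Fin n) (u∈R : u ∈ R) (heavy : m ≤ ∣ subtree u ∣)
                 (light : ∀ {c} → Child u c → ∣ subtree c ∣ < m) where

      InPiece : List (Fin n) → Fin n → Set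
      InPiece cs x = x ≡ u ⊎ (x ∈ R × Any (λ c → Child u c × c ≼ x) cs)

      InPiece? : ∀ cs x → Dec (InPiece cs x)
      InPiece? cs x = (x ≟ᶠ u) ⊎-dec ((x ∈? R) ×-dec Any.any? (λ c → child? u c ×-dec (c ≼? x)) cs)

      piece : List (Fin n) → Subset n
      piece cs = subset (InPiece? cs)

      ∈-piece⁺ : ∀ cs {x} → InPiece cs x → x ∈ piece cs
      ∈-piece⁺ cs = ∈-subset⁺ (InPiece? cs)

      ∈-piece⁻ : ∀ cs {x} → x ∈ piece cs → InPiece cs x
      ∈-piece⁻ cs = ∈-subset⁻ (InPiece? cs)

      piece⊆R : ∀ cs {x} → x ∈ piece cs → x ∈ R
      piece⊆R cs x∈ with ∈-piece⁻ cs x∈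
      ... | inj₁ refl      = u∈R
      ... | inj₂ (x∈R , _) = x∈R

      u≼ : ∀ cs {x} → x ∈ piece cs → u ≼ x
      u≼ cs x∈ with ∈-piece⁻ cs x∈
      ... | inj₁ refl     = here
      ... | inj₂ (_ , below) with Any.satisfied below
      ...   | c , (_ , c≢r , refl) , c≼x = ≼-trans (parent≼ c≢r) c≼x

      piece-up : ∀ cs {x} → x ∈ piece cs → x ≢ u → x ≢ root × parent x ∈ piece cs
      piece-up cs {x} x∈ x≢u with ∈-piece⁻ cs x∈
      ... | inj₁ x≡u          = contradiction x≡u x≢u
      ... | inj₂ (x∈R , below) = x≢r , p∈
        where
          x≢r : x ≢ root
          x≢r refl with Any.satisfied below
          ... | c , (_ , c≢r , _) , c≼r = c≢r (≼-root c≼r)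
          step-up : parent x ≢ u → ∀ {c} → Child u c × c ≼ x → Child u c × c ≼ parent x
          step-up p≢u ((_ , _ , p≡u) , here) = contradiction p≡u p≢u
          step-up p≢u (c-child , there _ c≼p) = c-child , c≼p
          p∈ : parent x ∈ piece cs
          p∈ with parent x ≟ᶠ u
          ... | yes p≡u = ∈-piece⁺ cs (inj₁ p≡u)
          ... | no  p≢u = ∈-piece⁺ cs (inj₂ (proj₂ (proj₂ R-region x∈R x≢r) , Any.map (step-up p≢u) below))

      piece-down : ∀ cs {x} → x ∈ R → x ≢ root → parent x ∈ piece cs → parent x ≢ u → x ∈ piece cs
      piece-down cs x∈R x≢r p∈ p≢u with ∈-piece⁻ cs p∈
      ... | inj₁ p≡u          = contradiction p≡u p≢u
      ... | inj₂ (_ , below) =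
        ∈-piece⁺ cs (inj₂ (x∈R , Any.map (λ (c-child , c≼p) → c-child , there x≢r c≼p) below))

      subtree⊆piece : subtree u ⊆ piece (allFin n)
      subtree⊆piece {x} x∈ with ∈-subtree⁻ x∈ | u ≟ᶠ x
      ... | _         | yes refl = ∈-piece⁺ (allFin n) (inj₁ refl)
      ... | x∈R , u≼x | no  u≢x  with ≼-child u≼x u≢x
      ...   | c , (c≢r , p≡u) , c≼x = ∈-piece⁺ (allFin n) (inj₂ (x∈R ,
              Any.map (λ { refl → (Region-≼ R-region x∈R c≼x , c≢r , p≡u) , c≼x }) (∈-allFin c)))

      piece-∷⁻ : ∀ c cs {x} → x ∈ piece (c ∷ cs) → x ∈ piece cs ⊎ (Child u c × x ∈ subtree c)
      piece-∷⁻ c cs x∈ with ∈-piece⁻ (c ∷ cs) x∈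
      ... | inj₁ x≡u                         = inj₁ (∈-piece⁺ cs (inj₁ x≡u))
      ... | inj₂ (x∈R , here (c-child , c≼x)) = inj₂ (c-child , ∈-subtree⁺ x∈R c≼x)
      ... | inj₂ (x∈R , there below)          = inj₁ (∈-piece⁺ cs (inj₂ (x∈R , below)))

      ∣piece[]∣<2m : ∣ piece [] ∣ < m + m
      ∣piece[]∣<2m = ≤-<-trans (p⊆q⇒∣p∣≤∣q∣ piece[]⊆⁅u⁆) (subst (_< m + m) (sym (∣⁅x⁆∣≡1 u)) (+-mono-≤ 1≤m 1≤m))
        where
          piece[]⊆⁅u⁆ : piece [] ⊆ ⁅ u ⁆
          piece[]⊆⁅u⁆ x∈ with ∈-piece⁻ [] x∈
          ... | inj₁ refl = x∈⁅x⁆ u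

      ∣piece-∷∣<2m : ∀ c cs → ∣ piece cs ∣ < m → ∣ piece (c ∷ cs) ∣ < m + m
      ∣piece-∷∣<2m c cs small with child? u c
      ... | yes c-child = ≤-<-trans (p⊆q⇒∣p∣≤∣q∣ (x∈p∪q⁺ ∘ Sum.map₂ proj₂ ∘ piece-∷⁻ c cs))
                            (≤-<-trans (∣p∪q∣≤∣p∣+∣q∣ (piece cs) (subtree c)) (+-mono-< small (light c-child)))
      ... | no  ¬child  = ≤-<-trans (p⊆q⇒∣p∣≤∣q∣ ([ id , (λ (c-child , _) → contradiction c-child ¬child) ]′ ∘ piece-∷⁻ c cs))
                            (<-≤-trans small (m≤m+n m m))

      balanced : Σ[ cs ∈ List (Fin n) ] m ≤ ∣ piece cs ∣ × ∣ piece cs ∣ < m + m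
      balanced = window (λ cs → ∣ piece cs ∣) ∣piece[]∣<2m ∣piece-∷∣<2m (allFin n)
                   (≤-trans heavy (p⊆q⇒∣p∣≤∣q∣ subtree⊆piece))

    split : m ≤ ∣ R ∣ → Split R m
    split m≤∣R∣ with heavy-below root (proj₁ R-region) (≤-trans m≤∣R∣ (p⊆q⇒∣p∣≤∣q∣ R⊆subtree-root))
    ... | u , u∈R , heavy , light = record
      { top          = u
      ; piece        = piece cs
      ; piece-rooted = ∈-piece⁺ cs (inj₁ refl) , piece-up cs
      ; piece⊆R      = piece⊆R cs
      ; top≼         = u≼ cs
      ; piece-down   = piece-down cs
      ; m≤∣piece∣    = proj₁ (proj₂ balanced)
      ; ∣piece∣<2m   = proj₂ (proj₂ balanced)
      }
      where
        open Piece u u∈R heavy light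
        cs : List (Fin n)
        cs = proj₁ balanced

  record Peel (R : Subset n) (m : ℕ) : Set where
    field
      top          : Fin n
      piece rest   : Subset n
      piece-rooted : RootedAt top piece
      rest-region  : Region rest
      piece⊆R      : piece ⊆ R
      rest⊆R       : rest ⊆ R
      piece∩rest   : ∀ {x} → x ∈ piece → x ∈ rest → x ≡ top
      cover        : ∀ {x} → x ∈ R → x ≢ root → (x ∈ piece × parent x ∈ piece) ⊎ (x ∈ rest × parent x ∈ rest)
      m≤∣piece∣    : m ≤ ∣ piece ∣
      ∣piece∣<2m   : ∣ piece ∣ < m + m
      ∣R∣≤         : ∣ R ∣ ≤ ∣ piece ∣ + ∣ rest ∣

  module Remainder {R m} (R-region : Region R) (S : Split R m) where

    open Split S

    Remains? : ∀ x → Dec (x ∈ R × (x ∉ piece ⊎ x ≡ top))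
    Remains? x = (x ∈? R) ×-dec (¬? (x ∈? piece) ⊎-dec (x ≟ᶠ top))

    rest : Subset n
    rest = subset Remains?

    ∈-rest⁺ : ∀ {x} → x ∈ R → x ∉ piece ⊎ x ≡ top → x ∈ rest
    ∈-rest⁺ x∈R h = ∈-subset⁺ Remains? (x∈R , h)

    ∈-rest⁻ : ∀ {x} → x ∈ rest → x ∈ R × (x ∉ piece ⊎ x ≡ top)
    ∈-rest⁻ = ∈-subset⁻ Remains?

    piece∩rest : ∀ {x} → x ∈ piece → x ∈ rest → x ≡ top
    piece∩rest x∈p x∈r with proj₂ (∈-rest⁻ x∈r)
    ... | inj₁ x∉p   = contradiction x∈p x∉p
    ... | inj₂ x≡top = x≡top

    piece-or-rest : ∀ {x} → x ∈ R → x ∈ piece ⊎ x ∈ rest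
    piece-or-rest {x} x∈R with x ∈? piece
    ... | yes x∈p = inj₁ x∈p
    ... | no  x∉p = inj₂ (∈-rest⁺ x∈R (inj₁ x∉p))

    root∈rest : root ∈ rest
    root∈rest with root ∈? piece
    ... | yes r∈p = ∈-rest⁺ (proj₁ R-region) (inj₂ (sym (≼-root (top≼ r∈p))))
    ... | no  r∉p = ∈-rest⁺ (proj₁ R-region) (inj₁ r∉p)

    parent∈rest : ∀ {x} → x ∈ rest → x ≢ root → parent x ∈ rest
    parent∈rest {x} x∈r x≢r = ∈-rest⁺ (proj₂ (proj₂ R-region x∈R x≢r)) outside-or-top
      where
        x∈R : x ∈ R
        x∈R = proj₁ (∈-rest⁻ x∈r)
        -- Otherwise piece-down puts x into the piece, so x is the top, which lies below its own parent.
        outside-or-top : parent x ∉ piece ⊎ parent x ≡ top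
        outside-or-top with parent x ≟ᶠ top | parent x ∈? piece
        ... | yes p≡top | _       = inj₂ p≡top
        ... | no  _     | no  p∉p = inj₁ p∉p
        ... | no  p≢top | yes p∈p with piece∩rest (piece-down x∈R x≢r p∈p p≢top) x∈r
        ...   | refl = contradiction (top≼ p∈p) (⋠-parent x≢r)

    rest-region : Region rest
    rest-region = root∈rest , λ x∈r x≢r → x≢r , parent∈rest x∈r x≢r

    cover : ∀ {x} → x ∈ R → x ≢ root → (x ∈ piece × parent x ∈ piece) ⊎ (x ∈ rest × parent x ∈ rest)
    cover {x} x∈R x≢r with piece-or-rest x∈R | x ≟ᶠ top
    ... | inj₂ x∈r | _         = inj₂ (x∈r , parent∈rest x∈r x≢r)
    ... | inj₁ _   | yes x≡top = inj₂ (x∈top , parent∈rest x∈top x≢r)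
      where x∈top = ∈-rest⁺ x∈R (inj₂ x≡top)
    ... | inj₁ x∈p | no  x≢top = inj₁ (x∈p , proj₂ (proj₂ piece-rooted x∈p x≢top))

    peel-off : Peel R m
    peel-off = record
      { top          = top
      ; piece        = piece
      ; rest         = rest
      ; piece-rooted = piece-rooted
      ; rest-region  = rest-region
      ; piece⊆R      = piece⊆R
      ; rest⊆R       = proj₁ ∘ ∈-rest⁻
      ; piece∩rest   = piece∩rest
      ; cover        = cover
      ; m≤∣piece∣    = m≤∣piece∣
      ; ∣piece∣<2m   = ∣piece∣<2m
      ; ∣R∣≤         = ≤-trans (p⊆q⇒∣p∣≤∣q∣ (x∈p∪q⁺ ∘ piece-or-rest)) (∣p∪q∣≤∣p∣+∣q∣ piece rest)
      }

  peel : ∀ {R m} → Region R → 1 ≤ m → m ≤ ∣ R ∣ → Peel R m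
  peel R-region 1≤m m≤∣R∣ = Remainder.peel-off R-region (split R-region 1≤m m≤∣R∣)

  peel-within : ∀ {R m q k} → Region R → 1 ≤ m → m ≤ q → (2 + k) * q ≤ ∣ R ∣ →
                Σ[ P ∈ Peel R m ] k * q ≤ ∣ Peel.rest P ∣
  peel-within {R} {m} {q} {k} R-region 1≤m m≤q large = P , +-cancelˡ-≤ (q + q) _ _ (begin
      (q + q) + k * q      ≡⟨ +-assoc q q (k * q) ⟩
      (2 + k) * q          ≤⟨ large ⟩
      ∣ R ∣                ≤⟨ ∣R∣≤ ⟩
      ∣ piece ∣ + ∣ rest ∣ ≤⟨ +-monoˡ-≤ ∣ rest ∣ (<⇒≤ (<-≤-trans ∣piece∣<2m (+-mono-≤ m≤q m≤q))) ⟩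
      (q + q) + ∣ rest ∣   ∎)
    where
      open ≤-Reasoning
      P : Peel R m
      P = peel R-region 1≤m (≤-trans m≤q (≤-trans (m≤m+n q _) large))
      open Peel P

  ∣piece∣-bounds : ∀ {R m} (P : Peel R m) → m ≤ ∣ Peel.piece P ∣ × ∣ Peel.piece P ∣ ≤ 3 * m
  ∣piece∣-bounds {m = m} P =
    Peel.m≤∣piece∣ P , ≤-trans (<⇒≤ (Peel.∣piece∣<2m P)) (+-monoʳ-≤ m (m≤m+n m (m + 0)))

module Decomposition {n : ℕ} {ET : Fin n → Fin n → Set} (tree : IsTree (onAll ET)) where

  open import Data.Fin.Subset using (_∈_)

  open IsTree tree using (isGraph; acyclic)
  open Rooting (tree⇒Rooting tree)
  open Ancestry arborescence
  open Splitting arborescence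

  induced : Subset n → Graph n
  induced S = record { V = S ; E = λ x y → ET x y × x ∈ S × y ∈ S }

  induced-isGraph : ∀ S → IsGraph (induced S)
  induced-isGraph S = record
    { sym     = λ (e , x∈ , y∈) → IsGraph.sym isGraph e , y∈ , x∈
    ; irrefl  = IsGraph.irrefl isGraph ∘ proj₁
    ; endsInV = proj₂
    }

  induced-⊑ : ∀ S → induced S ⊑ onAll ET
  induced-⊑ S = (λ _ → ∈⊤) , proj₁

  induced-edgeDisjoint : ∀ {S S′ c} → (∀ {x} → x ∈ S → x ∈ S′ → x ≡ c) → EdgeDisjoint (induced S) (induced S′)
  induced-edgeDisjoint meet {x} {y} (e , x∈ , y∈) (_ , x∈′ , y∈′) =
    IsGraph.irrefl isGraph (subst (ET x) (trans (meet y∈ y∈′) (sym (meet x∈ x∈′))) e)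

  parent-edge : ∀ {S x} → x ≢ root → x ∈ S × parent x ∈ S → E (induced S) x (parent x)
  parent-edge x≢r (x∈ , p∈) = parent-adjacent x≢r , x∈ , p∈

  tree-by-parents : ∀ (G : Graph n) → IsGraph G → G ⊑ onAll ET → ∀ t → t ∈ V G →
                    (∀ {x} → x ∈ V G → x ≢ t → x ≢ root × E G x (parent x)) → IsTree G
  tree-by-parents G G-graph G⊑ t t∈ climb = record
    { isGraph   = G-graph
    ; nonempty  = t , t∈
    ; connected = λ x∈ y∈ → toTop _ x∈ ++ʷ reverseʷ G-graph (toTop _ y∈)
    ; acyclic   = Acyclic-mono (proj₂ G⊑) acyclic
    }
    where
      toTop : ∀ x → x ∈ V G → Walk G x t
      toTop = depth-rec (λ x → x ∈ V G → Walk G x t) walk-up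
        where
          walk-up : ∀ x → (x ≢ root → parent x ∈ V G → Walk G (parent x) t) → x ∈ V G → Walk G x t
          walk-up x rec x∈ with x ≟ᶠ t
          ... | yes refl = here x∈
          ... | no  x≢t  with climb x∈ x≢t
          ...   | x≢r , e = step e (rec x≢r (proj₂ (IsGraph.endsInV G-graph e)))

  induced-tree : ∀ {t S} → RootedAt t S → IsTree (induced S)
  induced-tree {t} {S} (t∈ , up) =
    tree-by-parents (induced S) (induced-isGraph S) (induced-⊑ S) t t∈ λ x∈ x≢t →
      let x≢r , p∈ = up x∈ x≢t in x≢r , parent-edge x≢r (x∈ , p∈)

  module ThreePeels {m₁ m₃ m₄} (P₁ : Peel ⊤ m₄) (P₂ : Peel (Peel.rest P₁) m₃) (P₃ : Peel (Peel.rest P₂) m₁) where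

    private
      module P₁ = Peel P₁
      module P₂ = Peel P₂
      module P₃ = Peel P₃

    T₁ T₂ T₃ T₄ : Graph n
    T₁ = induced P₃.piece
    T₂ = induced P₃.rest
    T₃ = induced P₂.piece
    T₄ = induced P₁.piece

    T₁₂-parent-edge : ∀ {x} → x ∈ P₂.rest → x ≢ root → E (T₁ ∪G T₂) x (parent x)
    T₁₂-parent-edge x∈ x≢r = Sum.map (parent-edge x≢r) (parent-edge x≢r) (P₃.cover x∈ x≢r)

    T₁₂₃-parent-edge : ∀ {x} → x ∈ P₁.rest → x ≢ root → E (T₁ ∪G (T₂ ∪G T₃)) x (parent x)
    T₁₂₃-parent-edge x∈ x≢r with P₂.cover x∈ x≢r
    ... | inj₁ pair      = inj₂ (inj₂ (parent-edge x≢r pair))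
    ... | inj₂ (x∈₂ , _) = Sum.map₂ inj₁ (T₁₂-parent-edge x∈₂ x≢r)

    T₁₂₃₄-parent-edge : ∀ {x} → x ≢ root → E (T₁ ∪G (T₂ ∪G (T₃ ∪G T₄))) x (parent x)
    T₁₂₃₄-parent-edge x≢r with P₁.cover ∈⊤ x≢r
    ... | inj₁ pair      = inj₂ (inj₂ (inj₂ (parent-edge x≢r pair)))
    ... | inj₂ (x∈₁ , _) = Sum.map₂ (Sum.map₂ inj₁) (T₁₂₃-parent-edge x∈₁ x≢r)

    covers : ∀ {x y} → ET x y → E (T₁ ∪G (T₂ ∪G (T₃ ∪G T₄))) x y
    covers e with adjacent⇒parent e
    ... | inj₁ (x≢r , refl) = T₁₂₃₄-parent-edge x≢r
    ... | inj₂ (y≢r , refl) = IsGraph.sym T₁₂₃₄-isGraph (T₁₂₃₄-parent-edge y≢r)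
      where
        T₁₂₃₄-isGraph : IsGraph (T₁ ∪G (T₂ ∪G (T₃ ∪G T₄)))
        T₁₂₃₄-isGraph = ∪G-isGraph (induced-isGraph _) (∪G-isGraph (induced-isGraph _)
                          (∪G-isGraph (induced-isGraph _) (induced-isGraph _)))

    T₁₂-tree : IsTree (T₁ ∪G T₂)
    T₁₂-tree = tree-by-parents (T₁ ∪G T₂) (∪G-isGraph (induced-isGraph _) (induced-isGraph _))
      (∪G-⊑ (induced-⊑ _) (induced-⊑ _)) root (x∈p∪q⁺ (inj₂ (proj₁ P₃.rest-region)))
      λ x∈ x≢r → x≢r , T₁₂-parent-edge (in-R₂ x∈) x≢r
      where
        in-R₂ : ∀ {x} → x ∈ P₃.piece ∪ P₃.rest → x ∈ P₂.rest
        in-R₂ = [ P₃.piece⊆R , P₃.rest⊆R ]′ ∘ x∈p∪q⁻ P₃.piece P₃.rest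

    T₁₂₃-tree : IsTree (T₁ ∪G (T₂ ∪G T₃))
    T₁₂₃-tree = tree-by-parents (T₁ ∪G (T₂ ∪G T₃))
      (∪G-isGraph (induced-isGraph _) (∪G-isGraph (induced-isGraph _) (induced-isGraph _)))
      (∪G-⊑ (induced-⊑ _) (∪G-⊑ (induced-⊑ _) (induced-⊑ _))) root
      (x∈p∪q⁺ (inj₂ (x∈p∪q⁺ (inj₁ (proj₁ P₃.rest-region)))))
      λ x∈ x≢r → x≢r , T₁₂₃-parent-edge (in-R₁ x∈) x≢r
      where
        in-R₁ : ∀ {x} → x ∈ P₃.piece ∪ (P₃.rest ∪ P₂.piece) → x ∈ P₁.rest
        in-R₁ x∈ with x∈p∪q⁻ P₃.piece _ x∈
        ... | inj₁ x∈₃ = P₂.rest⊆R (P₃.piece⊆R x∈₃)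
        ... | inj₂ x∈′ = [ P₂.rest⊆R ∘ P₃.rest⊆R , P₂.piece⊆R ]′ (x∈p∪q⁻ P₃.rest P₂.piece x∈′)

    trees : IsTree T₁ × IsTree T₂ × IsTree T₃ × IsTree T₄
    trees = induced-tree P₃.piece-rooted , induced-tree P₃.rest-region ,
            induced-tree P₂.piece-rooted , induced-tree P₁.piece-rooted

    subtrees : T₁ ⊑ onAll ET × T₂ ⊑ onAll ET × T₃ ⊑ onAll ET × T₄ ⊑ onAll ET
    subtrees = induced-⊑ _ , induced-⊑ _ , induced-⊑ _ , induced-⊑ _

    T₁-size : m₁ ≤ ∣ V T₁ ∣ × ∣ V T₁ ∣ ≤ 3 * m₁
    T₁-size = ∣piece∣-bounds P₃

    T₃-size : m₃ ≤ ∣ V T₃ ∣ × ∣ V T₃ ∣ ≤ 3 * m₃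
    T₃-size = ∣piece∣-bounds P₂

    T₄-size : m₄ ≤ ∣ V T₄ ∣ × ∣ V T₄ ∣ ≤ 3 * m₄
    T₄-size = ∣piece∣-bounds P₁

    pairwise-edgeDisjoint : EdgeDisjoint T₁ T₂ × EdgeDisjoint T₁ T₃ × EdgeDisjoint T₁ T₄ ×
                            EdgeDisjoint T₂ T₃ × EdgeDisjoint T₂ T₄ × EdgeDisjoint T₃ T₄
    pairwise-edgeDisjoint =
        induced-edgeDisjoint P₃.piece∩rest
      , induced-edgeDisjoint (λ a₃ a₂ → P₂.piece∩rest a₂ (P₃.piece⊆R a₃))
      , induced-edgeDisjoint (λ a₃ a₁ → P₁.piece∩rest a₁ (P₂.rest⊆R (P₃.piece⊆R a₃)))
      , induced-edgeDisjoint (λ r₃ a₂ → P₂.piece∩rest a₂ (P₃.rest⊆R r₃))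
      , induced-edgeDisjoint (λ r₃ a₁ → P₁.piece∩rest a₁ (P₂.rest⊆R (P₃.rest⊆R r₃)))
      , induced-edgeDisjoint (λ a₂ a₁ → P₁.piece∩rest a₁ (P₂.piece⊆R a₂))

proposition4p3 : (n m₁ m₃ m₄ : ℕ) →
    1 ≤ m₁ → m₁ ≤ n / 10 → 1 ≤ m₃ → m₃ ≤ n / 10 → 1 ≤ m₄ → m₄ ≤ n / 10 →
    (ET : Fin n → Fin n → Set) → IsTree (onAll ET) →
    Σ[ T₁ ∈ Graph n ] Σ[ T₂ ∈ Graph n ] Σ[ T₃ ∈ Graph n ] Σ[ T₄ ∈ Graph n ]
      (IsTree T₁ × IsTree T₂ × IsTree T₃ × IsTree T₄) ×
      (T₁ ⊑ onAll ET × T₂ ⊑ onAll ET × T₃ ⊑ onAll ET × T₄ ⊑ onAll ET) ×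
      (EdgeDisjoint T₁ T₂ × EdgeDisjoint T₁ T₃ × EdgeDisjoint T₁ T₄ ×
       EdgeDisjoint T₂ T₃ × EdgeDisjoint T₂ T₄ × EdgeDisjoint T₃ T₄) ×
      (∀ {x y} → ET x y → E (T₁ ∪G (T₂ ∪G (T₃ ∪G T₄))) x y) ×
      (m₁ ≤ ∣ V T₁ ∣ × ∣ V T₁ ∣ ≤ 3 * m₁) ×
      (m₃ ≤ ∣ V T₃ ∣ × ∣ V T₃ ∣ ≤ 3 * m₃) ×
      (m₄ ≤ ∣ V T₄ ∣ × ∣ V T₄ ∣ ≤ 3 * m₄) ×
      IsTree (T₁ ∪G T₂) × IsTree (T₁ ∪G (T₂ ∪G T₃))
proposition4p3 n m₁ m₃ m₄ 1≤m₁ m₁≤q 1≤m₃ m₃≤q 1≤m₄ m₄≤q ET tree =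
  T₁ , T₂ , T₃ , T₄ , trees , subtrees , pairwise-edgeDisjoint , covers ,
  T₁-size , T₃-size , T₄-size , T₁₂-tree , T₁₂₃-tree
  where
    open Decomposition tree
    open Rooting (tree⇒Rooting tree) using (arborescence)
    open Ancestry arborescence using (⊤-region)
    open Splitting arborescence

    q : ℕ
    q = n / 10

    10q≤n : 10 * q ≤ ∣ ⊤ {n} ∣
    10q≤n = subst (10 * q ≤_) (sym (∣⊤∣≡n n)) (≤-trans (≤-reflexive (*-comm 10 q)) (m/n*n≤m n 10))

    first : Σ[ P ∈ Peel ⊤ m₄ ] 8 * q ≤ ∣ Peel.rest P ∣
    first = peel-within {k = 8} ⊤-region 1≤m₄ m₄≤q 10q≤n

    second : Σ[ P ∈ Peel (Peel.rest (proj₁ first)) m₃ ] 6 * q ≤ ∣ Peel.rest P ∣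
    second = peel-within {k = 6} (Peel.rest-region (proj₁ first)) 1≤m₃ m₃≤q (proj₂ first)

    third : Σ[ P ∈ Peel (Peel.rest (proj₁ second)) m₁ ] 4 * q ≤ ∣ Peel.rest P ∣
    third = peel-within {k = 4} (Peel.rest-region (proj₁ second)) 1≤m₁ m₁≤q (proj₂ second)

    open ThreePeels (proj₁ first) (proj₁ second) (proj₁ third)
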